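{- Let $a\in\mathbb{N}$, $a\ge 3$, $S=\langle a,a+1,a+2\rangle$, let $r\in S$ with $r\neq 0$ and let $\alpha\in\operatorname{F}(r,S)$. Then: (1) $|\alpha|a\le r\le |\alpha|(a+2)$; (2) $|\alpha|\le\lfloor r/a\rfloor$; (3) $\lfloor r/a\rfloor\le |\alpha|+\sum_{j=0}^{|\alpha|-1}\lfloor (2|\alpha|+aj)/(a|\alpha|)\rfloor$; (4) if $r\le\operatorname{Frob}(S)$, then $|\alpha|=\lfloor r/a\rfloor$ and $\lfloor r/a\rfloor<\lfloor a/2\rfloor$; (5) if $r>\operatorname{Frob}(S)$, then $\lfloor a/2\rfloor\le|\alpha|$; (6) if $r<\lfloor a/2\rfloor(a+2)$, then $\lfloor r/a\rfloor\le\lfloor a/2\rfloor$; (7) if $\operatorname{Frob}(S)<r<\lfloor a/2\rfloor(a+2)$, then $|\alpha|=\lfloor r/a\rfloor=\lfloor a/2\rfloor$. Suppose $a$ is even, so $\mathscr{L}_a=\lfloor a/2\rfloor(a+2)$: (8) if $r\ge\mathscr{L}_a$ then $\lfloor r/a\rfloor>\lfloor a/2\rfloor$; and if $r=\mathscr{L}_a$, then $(0,0,\lfloor a/2\rfloor)$ and $(\lfloor a/2\rfloor+1,0,0)$ are two factorizations of $r$ of different length. Suppose $a$ is odd, so $\mathscr{L}_a=(\lfloor a/2\rfloor+2)a$: (9) if $r=\lfloor a/2\rfloor(a+2)$, then $|\alpha|=\lfloor r/a\rfloor=\lfloor a/2\rfloor$; (10) if $\lfloor a/2\rfloor(a+2)<r<\mathscr{L}_a$,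 then $|\alpha|=\lfloor r/a\rfloor=\lfloor a/2\rfloor+1$; (11) if $r\ge\mathscr{L}_a$ then $\lfloor r/a\rfloor>\lfloor a/2\rfloor+1$; and if $r=\mathscr{L}_a$, then $(0,1,\lfloor a/2\rfloor)$ and $(\lfloor a/2\rfloor+2,0,0)$ are two factorizations of $r$ of different length.
   Context: $\mathbb{N}=\{0,1,2,\dots\}$. $S=\langle a,a+1,a+2\rangle=\{\alpha_1a+\alpha_2(a+1)+\alpha_3(a+2):\alpha_i\in\mathbb{N}\}$. $\operatorname{F}(r,S)=\{\alpha\in\mathbb{N}^3:\alpha_1a+\alpha_2(a+1)+\alpha_3(a+2)=r\}$, and $|\alpha|=\alpha_1+\alpha_2+\alpha_3$. $\operatorname{Frob}(S)$ denotes the Frobenius number of $S$, the largest integer not in $S$ (it is known to equal $\lfloor a/2\rfloor a-1$). $\mathscr{L}_a=\lfloor a/2\rfloor (a+2)$ if $a$ is even, and $\mathscr{L}_a=(\lfloor a/2\rfloor+2)a$ if $a$ is odd. -}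

module Defs where

open import Data.Nat using (ℕ; zero; suc; _+_; _*_; _∸_; _≤_; _<_; _%_; ⌊_/2⌋)
open import Data.Nat.DivMod using (_/_)
open import Data.Product using (Σ; _×_; _,_)
open import Relation.Binary.PropositionalEquality using (_≡_)
open import Relation.Nullary using (¬_)

Triple : Set
Triple = ℕ × ℕ × ℕ

eval : ℕ → Triple → ℕ
eval a (α₁ , α₂ , α₃) = α₁ * a + α₂ * (a + 1) + α₃ * (a + 2)

IsFact : ℕ → ℕ → Triple → Set
IsFact a r α = eval a α ≡ r

InS : ℕ → ℕ → Set
InS a r = Σ Triple (λ α → IsFact a r α)

len : Triple → ℕ
len (α₁ , α₂ , α₃) = α₁ + α₂ + α₃

-- Floor division, with the (unused) convention m div 0 = 0.
div : ℕ → ℕ → ℕ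
div m zero = 0
div m (suc k) = m / suc k

IsFrob : ℕ → ℕ → Set
IsFrob a f = ¬ InS a f × (∀ n → f < n → InS a n)

-- Σ_{j=0}^{k-1} ⌊(2n + a j)/(a n)⌋  (called with k = n = |α|).
sumTerm : ℕ → ℕ → ℕ → ℕ
sumTerm a n zero = 0
sumTerm a n (suc j) = sumTerm a n j + div (2 * n + a * j) (a * n)

La : ℕ → ℕ
La a with a % 2
... | zero = ⌊ a /2⌋ * (a + 2)
... | suc _ = (⌊ a /2⌋ + 2) * a

{-# OPTIONS --safe #-}

-- Write eval a α = |α| a + e with excess e = α₂ + 2α₃ ∈ [0, 2|α|]; every such pair (|α|, e)
-- occurs, so S is the union of the blocks [n a, n a + 2n].  While n < ⌊a/2⌋ a block ends at
-- least two below (n + 1) a, so |α| = ⌊r/a⌋ whenever r < ⌊a/2⌋ a, and ⌊a/2⌋ a − 1 ∉ S; from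
-- n = ⌊a/2⌋ on consecutive blocks meet, so Frob(S) = ⌊a/2⌋ a − 1.  The remaining items compare
-- r with the block ends ⌊a/2⌋ (a + 2) and (⌊a/2⌋ + 1) a, which coincide for even a and differ
-- by one for odd a.  In (3), ⌊e/a⌋ ≤ ⌊2|α|/a⌋ is bounded by the last ⌊e/a⌋ terms of the sum,
-- each of which is at least 1.

module Submission where

open import Defs
open import Data.Nat
  using (ℕ; zero; suc; pred; NonZero; >-nonZero; _+_; _*_; _/_; _%_; ⌊_/2⌋;
         _≤_; _<_; _≥_; _>_; z≤n; s≤s; s≤s⁻¹)
open import Data.Nat.Properties
open import Data.Nat.DivMod
open import Data.Nat.Divisibility using (n∣m*n)
open import Data.Nat.Tactic.RingSolver using (solve-∀)
open import Data.Product using (_×_; _,_; ∃-syntax)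
open import Function using (_∘_)
open import Relation.Nullary using (yes; no)
open import Relation.Binary.PropositionalEquality
  using (_≡_; _≢_; refl; sym; trans; cong; subst; module ≡-Reasoning)

excess : Triple → ℕ
excess (_ , α₂ , α₃) = α₂ + (α₃ + α₃)

eval≡len*a+excess : ∀ a α → eval a α ≡ len α * a + excess α
eval≡len*a+excess a (α₁ , α₂ , α₃) = identity a α₁ α₂ α₃
  where
  identity : ∀ a x y z →
             x * a + y * (a + 1) + z * (a + 2) ≡ (x + y + z) * a + (y + (z + z))
  identity = solve-∀

excess≤len+len : ∀ α → excess α ≤ len α + len α
excess≤len+len (α₁ , α₂ , α₃) = begin
  α₂ + (α₃ + α₃)                ≡⟨ +-assoc α₂ α₃ α₃ ⟨
  α₂ + α₃ + α₃                  ≤⟨ +-mono-≤ (+-monoˡ-≤ α₃ (m≤n+m α₂ α₁)) (m≤n+m α₃ (α₁ + α₂)) ⟩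
  α₁ + α₂ + α₃ + (α₁ + α₂ + α₃) ∎
  where open ≤-Reasoning

len[k,0,0]≡k : ∀ k → len (k , 0 , 0) ≡ k
len[k,0,0]≡k k = trans (+-identityʳ _) (+-identityʳ _)

len-excess-onto : ∀ n e → e ≤ n + n → ∃[ α ] len α ≡ n × excess α ≡ e
len-excess-onto zero    zero          _ = (0 , 0 , 0) , refl , refl
len-excess-onto (suc n) zero          _ = (suc n , 0 , 0) , len[k,0,0]≡k (suc n) , refl
len-excess-onto (suc n) (suc zero)    _ = (n , 1 , 0) , trans (+-identityʳ _) (+-comm n 1) , refl
len-excess-onto (suc n) (suc (suc e)) 2+e≤2+2n
  with len-excess-onto n e (s≤s⁻¹ (subst (suc e ≤_) (+-suc n n) (s≤s⁻¹ 2+e≤2+2n)))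
... | (α₁ , α₂ , α₃) , refl , refl = (α₁ , α₂ , suc α₃) , +-suc (α₁ + α₂) α₃ , shift α₂ α₃
  where
  shift : ∀ y z → y + (suc z + suc z) ≡ suc (suc (y + (z + z)))
  shift = solve-∀

n*a+[n+n]≡n*[a+2] : ∀ n a → n * a + (n + n) ≡ n * (a + 2)
n*a+[n+n]≡n*[a+2] = solve-∀

len*a≤eval : ∀ a α → len α * a ≤ eval a α
len*a≤eval a α = subst (len α * a ≤_) (sym (eval≡len*a+excess a α)) (m≤m+n _ _)

eval≤len*[a+2] : ∀ a α → eval a α ≤ len α * (a + 2)
eval≤len*[a+2] a α = begin
  eval a α                    ≡⟨ eval≡len*a+excess a α ⟩
  len α * a + excess α        ≤⟨ +-monoʳ-≤ (len α * a) (excess≤len+len α) ⟩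
  len α * a + (len α + len α) ≡⟨ n*a+[n+n]≡n*[a+2] (len α) a ⟩
  len α * (a + 2)             ∎
  where open ≤-Reasoning

*[a+2]<eval⇒<len : ∀ a k α → k * (a + 2) < eval a α → k < len α
*[a+2]<eval⇒<len a k α lt = *-cancelʳ-< (a + 2) k (len α) (<-≤-trans lt (eval≤len*[a+2] a α))

module _ {n : ℕ} ⦃ _ : NonZero n ⦄ where

  [m*n+o]/n≡m+o/n : ∀ m o → (m * n + o) / n ≡ m + o / n
  [m*n+o]/n≡m+o/n m o = trans (+-distrib-/-∣ˡ o (n∣m*n m)) (cong (_+ o / n) (m*n/n≡m m n))

  [m*n+o]/n≡m : ∀ m {o} → o < n → (m * n + o) / n ≡ m
  [m*n+o]/n≡m m {o} o<n =
    trans ([m*n+o]/n≡m+o/n m o) (trans (cong (m +_) (m<n⇒m/n≡0 o<n)) (+-identityʳ m))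

  m*n≤o⇒m≤o/n : ∀ m {o} → m * n ≤ o → m ≤ o / n
  m*n≤o⇒m≤o/n m {o} le = subst (_≤ o / n) (m*n/n≡m m n) (/-monoˡ-≤ n le)

  o<[1+m]*n⇒o/n≤m : ∀ m {o} → o < suc m * n → o / n ≤ m
  o<[1+m]*n⇒o/n≤m m lt = s≤s⁻¹ (m<n*o⇒m/o<n lt)

≤-antisym₃ : ∀ {x y z} → x ≤ y → y ≤ z → z ≤ x → x ≡ y × y ≡ z
≤-antisym₃ x≤y y≤z z≤x = ≤-antisym x≤y (≤-trans y≤z z≤x) , ≤-antisym y≤z (≤-trans z≤x x≤y)

m≡m%2+[⌊m/2⌋+⌊m/2⌋] : ∀ m → m ≡ m % 2 + (⌊ m /2⌋ + ⌊ m /2⌋)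
m≡m%2+[⌊m/2⌋+⌊m/2⌋] zero          = refl
m≡m%2+[⌊m/2⌋+⌊m/2⌋] (suc zero)    = refl
m≡m%2+[⌊m/2⌋+⌊m/2⌋] (suc (suc m)) =
  trans (cong (suc ∘ suc) (m≡m%2+[⌊m/2⌋+⌊m/2⌋] m)) (shift (m % 2) ⌊ m /2⌋)
  where
  shift : ∀ r h → 2 + (r + (h + h)) ≡ r + (suc h + suc h)
  shift = solve-∀

⌊m/2⌋+⌊m/2⌋≤m : ∀ m → ⌊ m /2⌋ + ⌊ m /2⌋ ≤ m
⌊m/2⌋+⌊m/2⌋≤m m = subst (⌊ m /2⌋ + ⌊ m /2⌋ ≤_) (sym (m≡m%2+[⌊m/2⌋+⌊m/2⌋] m)) (m≤n+m _ (m % 2))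

m≤1+[⌊m/2⌋+⌊m/2⌋] : ∀ m → m ≤ suc (⌊ m /2⌋ + ⌊ m /2⌋)
m≤1+[⌊m/2⌋+⌊m/2⌋] m = ≤-trans (≤-reflexive (m≡m%2+[⌊m/2⌋+⌊m/2⌋] m))
                              (+-monoˡ-≤ (⌊ m /2⌋ + ⌊ m /2⌋) (s≤s⁻¹ (m%n<n m 2)))

m%2≡0⇒m≡⌊m/2⌋+⌊m/2⌋ : ∀ {m} → m % 2 ≡ 0 → m ≡ ⌊ m /2⌋ + ⌊ m /2⌋
m%2≡0⇒m≡⌊m/2⌋+⌊m/2⌋ {m} m%2≡0 =
  trans (m≡m%2+[⌊m/2⌋+⌊m/2⌋] m) (cong (_+ (⌊ m /2⌋ + ⌊ m /2⌋)) m%2≡0)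

m%2≡1⇒m≡1+[⌊m/2⌋+⌊m/2⌋] : ∀ {m} → m % 2 ≡ 1 → m ≡ suc (⌊ m /2⌋ + ⌊ m /2⌋)
m%2≡1⇒m≡1+[⌊m/2⌋+⌊m/2⌋] {m} m%2≡1 =
  trans (m≡m%2+[⌊m/2⌋+⌊m/2⌋] m) (cong (_+ (⌊ m /2⌋ + ⌊ m /2⌋)) m%2≡1)

La-even : ∀ a → a % 2 ≡ 0 → La a ≡ ⌊ a /2⌋ * (a + 2)
La-even a _ with a % 2
La-even a refl | zero = refl

La-odd : ∀ a → a % 2 ≡ 1 → La a ≡ (⌊ a /2⌋ + 2) * a
La-odd a _ with a % 2
La-odd a refl | suc _ = refl

len<⌊a/2⌋⇒2+excess≤a : ∀ a α → len α < ⌊ a /2⌋ → 2 + excess α ≤ a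
len<⌊a/2⌋⇒2+excess≤a a α n<h = begin
  2 + excess α        ≤⟨ s≤s (s≤s (excess≤len+len α)) ⟩
  2 + (n + n)         ≡⟨ cong suc (+-suc n n) ⟨
  suc n + suc n       ≤⟨ +-mono-≤ n<h n<h ⟩
  ⌊ a /2⌋ + ⌊ a /2⌋   ≤⟨ ⌊m/2⌋+⌊m/2⌋≤m a ⟩
  a                   ∎
  where
  n = len α
  open ≤-Reasoning

len<⌊a/2⌋⇒2+eval≤⌊a/2⌋*a : ∀ a α → len α < ⌊ a /2⌋ → 2 + eval a α ≤ ⌊ a /2⌋ * a
len<⌊a/2⌋⇒2+eval≤⌊a/2⌋*a a α n<h = begin
  2 + eval a α         ≡⟨ cong (2 +_) (eval≡len*a+excess a α) ⟩
  2 + (n * a + e)      ≡⟨ trans (+-suc (n * a) (suc e)) (cong suc (+-suc (n * a) e)) ⟨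
  n * a + (2 + e)      ≤⟨ +-monoʳ-≤ (n * a) (len<⌊a/2⌋⇒2+excess≤a a α n<h) ⟩
  n * a + a            ≡⟨ +-comm (n * a) a ⟩
  suc n * a            ≤⟨ *-monoˡ-≤ a n<h ⟩
  ⌊ a /2⌋ * a          ∎
  where
  n = len α
  e = excess α
  open ≤-Reasoning

⌊a/2⌋*a≤eval⇒⌊a/2⌋≤len : ∀ a α → ⌊ a /2⌋ * a ≤ eval a α → ⌊ a /2⌋ ≤ len α
⌊a/2⌋*a≤eval⇒⌊a/2⌋≤len a α h*a≤r = ≮⇒≥ λ n<h →
  1+n≰n (≤-trans (n≤1+n _) (≤-trans (len<⌊a/2⌋⇒2+eval≤⌊a/2⌋*a a α n<h) h*a≤r))

eval<⌊a/2⌋*a⇒len<⌊a/2⌋ : ∀ a α → eval a α < ⌊ a /2⌋ * a → len α < ⌊ a /2⌋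
eval<⌊a/2⌋*a⇒len<⌊a/2⌋ a α r<h*a = *-cancelʳ-< a (len α) ⌊ a /2⌋ (≤-<-trans (len*a≤eval a α) r<h*a)

e≤n+n⇒InS[n*a+e] : ∀ a n e → e ≤ n + n → InS a (n * a + e)
e≤n+n⇒InS[n*a+e] a n e e≤2n with len-excess-onto n e e≤2n
... | α , refl , refl = α , eval≡len*a+excess a α

⌊a/2⌋*a≤m⇒InS : ∀ a ⦃ _ : NonZero a ⦄ m → ⌊ a /2⌋ * a ≤ m → InS a m
⌊a/2⌋*a≤m⇒InS a m h*a≤m =
  subst (InS a) (sym m≡q*a+ρ) (e≤n+n⇒InS[n*a+e] a (m / a) (m % a) ρ≤q+q)
  where
  m≡q*a+ρ : m ≡ m / a * a + m % a
  m≡q*a+ρ = trans (m≡m%n+[m/n]*n m a) (+-comm (m % a) _)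
  h≤q = m*n≤o⇒m≤o/n ⌊ a /2⌋ h*a≤m
  ρ≤q+q = ≤-trans (s≤s⁻¹ (<-≤-trans (m%n<n m a) (m≤1+[⌊m/2⌋+⌊m/2⌋] a))) (+-mono-≤ h≤q h≤q)

InS⇒1+m≢⌊a/2⌋*a : ∀ a m → InS a m → suc m ≢ ⌊ a /2⌋ * a
InS⇒1+m≢⌊a/2⌋*a a .(eval a α) (α , refl) 1+r≡h*a with ⌊ a /2⌋ ≤? len α
... | yes h≤n = 1+n≰n (begin
  suc (eval a α) ≡⟨ 1+r≡h*a ⟩
  ⌊ a /2⌋ * a    ≤⟨ *-monoˡ-≤ a h≤n ⟩
  len α * a      ≤⟨ len*a≤eval a α ⟩
  eval a α       ∎)
  where open ≤-Reasoning
... | no h≰n = 1+n≰n (subst (2 + eval a α ≤_) (sym 1+r≡h*a)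
                        (len<⌊a/2⌋⇒2+eval≤⌊a/2⌋*a a α (≰⇒> h≰n)))

IsFrob⇒1+f≡⌊a/2⌋*a : ∀ a ⦃ _ : NonZero a ⦄ {f} → 2 ≤ a → IsFrob a f → suc f ≡ ⌊ a /2⌋ * a
IsFrob⇒1+f≡⌊a/2⌋*a a {f} 2≤a (f∉S , >f⇒InS) = ≤-antisym f<h*a h*a≤1+f
  where
  f<h*a : f < ⌊ a /2⌋ * a
  f<h*a = ≰⇒> (f∉S ∘ ⌊a/2⌋*a≤m⇒InS a f)
  instance
    h*a≢0 : NonZero (⌊ a /2⌋ * a)
    h*a≢0 = m*n≢0 ⌊ a /2⌋ a ⦃ >-nonZero (⌊n/2⌋-mono 2≤a) ⦄
  h*a≤1+f : ⌊ a /2⌋ * a ≤ suc f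
  h*a≤1+f = ≮⇒≥ λ 1+f<h*a →
    InS⇒1+m≢⌊a/2⌋*a a _ (>f⇒InS (pred (⌊ a /2⌋ * a)) (<⇒≤pred 1+f<h*a)) (suc-pred _)

div-pos : ∀ {m d} → 0 < d → d ≤ m → 0 < div m d
div-pos {d = suc _} _ d≤m = m≥n⇒m/n>0 d≤m

sumTerm-lower : ∀ {a n q} → 2 ≤ a → q * a ≤ n + n → ∀ j → j ≤ n → j + q ≤ sumTerm a n j + n
sumTerm-lower {a} {n} {q} 2≤a q*a≤2n zero _ =
  *-cancelʳ-≤ q n 2 (≤-trans (*-monoʳ-≤ q 2≤a) (subst (q * a ≤_) (n+n≡n*2 n) q*a≤2n))
  where
  n+n≡n*2 : ∀ n → n + n ≡ n * 2
  n+n≡n*2 = solve-∀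
sumTerm-lower {a} {n} {q} 2≤a q*a≤2n (suc j) 1+j≤n with suc j + q ≤? n
... | yes 1+j+q≤n = ≤-trans 1+j+q≤n (m≤n+m n _)
... | no 1+j+q≰n = begin
  suc j + q                        ≤⟨ s≤s (sumTerm-lower 2≤a q*a≤2n j (<⇒≤ 1+j≤n)) ⟩
  suc (S + n)                      ≡⟨ cong (_+ n) (+-comm 1 S) ⟩
  S + 1 + n                        ≤⟨ +-monoˡ-≤ n (+-monoʳ-≤ S (div-pos 0<a*n a*n≤2n+a*j)) ⟩
  sumTerm a n (suc j) + n          ∎
  where
  S = sumTerm a n j
  open ≤-Reasoning
  0<a*n : 0 < a * n
  0<a*n = *-mono-≤ {1} {a} {1} {n} (≤-trans (s≤s z≤n) 2≤a) (≤-trans (s≤s z≤n) 1+j≤n)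
  reorder : ∀ a j n → a * j + (n + n) ≡ 2 * n + a * j
  reorder = solve-∀
  a*n≤2n+a*j : a * n ≤ 2 * n + a * j
  a*n≤2n+a*j = begin
    a * n             ≤⟨ *-monoʳ-≤ a (s≤s⁻¹ (≰⇒> 1+j+q≰n)) ⟩
    a * (j + q)       ≡⟨ *-distribˡ-+ a j q ⟩
    a * j + a * q     ≤⟨ +-monoʳ-≤ (a * j) (subst (_≤ n + n) (*-comm q a) q*a≤2n) ⟩
    a * j + (n + n)   ≡⟨ reorder a j n ⟩
    2 * n + a * j     ∎

⌊a/2⌋*[a+2]≤[1+⌊a/2⌋]*a : ∀ a → ⌊ a /2⌋ * (a + 2) ≤ suc ⌊ a /2⌋ * a
⌊a/2⌋*[a+2]≤[1+⌊a/2⌋]*a a = begin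
  h * (a + 2)       ≡⟨ n*a+[n+n]≡n*[a+2] h a ⟨
  h * a + (h + h)   ≤⟨ +-monoʳ-≤ (h * a) (⌊m/2⌋+⌊m/2⌋≤m a) ⟩
  h * a + a         ≡⟨ +-comm (h * a) a ⟩
  suc h * a         ∎
  where
  h = ⌊ a /2⌋
  open ≤-Reasoning

a%2≡0⇒⌊a/2⌋*[a+2]≡[1+⌊a/2⌋]*a : ∀ a → a % 2 ≡ 0 → ⌊ a /2⌋ * (a + 2) ≡ suc ⌊ a /2⌋ * a
a%2≡0⇒⌊a/2⌋*[a+2]≡[1+⌊a/2⌋]*a a a%2≡0 = begin
  h * (a + 2)       ≡⟨ n*a+[n+n]≡n*[a+2] h a ⟨
  h * a + (h + h)   ≡⟨ cong (h * a +_) (m%2≡0⇒m≡⌊m/2⌋+⌊m/2⌋ a%2≡0) ⟨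
  h * a + a         ≡⟨ +-comm (h * a) a ⟩
  suc h * a         ∎
  where
  h = ⌊ a /2⌋
  open ≡-Reasoning

a%2≡1⇒⌊a/2⌋*[a+2]/a≡⌊a/2⌋ : ∀ a ⦃ _ : NonZero a ⦄ → a % 2 ≡ 1 → ⌊ a /2⌋ * (a + 2) / a ≡ ⌊ a /2⌋
a%2≡1⇒⌊a/2⌋*[a+2]/a≡⌊a/2⌋ a a%2≡1 =
  trans (/-congˡ (sym (n*a+[n+n]≡n*[a+2] h a)))
        ([m*n+o]/n≡m h (≤-reflexive (sym (m%2≡1⇒m≡1+[⌊m/2⌋+⌊m/2⌋] a%2≡1))))
  where h = ⌊ a /2⌋

a%2≡1⇒La≡[2+⌊a/2⌋]*a : ∀ a → a % 2 ≡ 1 → La a ≡ suc (⌊ a /2⌋ + 1) * a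
a%2≡1⇒La≡[2+⌊a/2⌋]*a a a%2≡1 = trans (La-odd a a%2≡1) (cong (_* a) (+-suc ⌊ a /2⌋ 1))

eval[k,0,0]≡k*a : ∀ a k → eval a (k , 0 , 0) ≡ k * a
eval[k,0,0]≡k*a a k = trans (+-identityʳ _) (+-identityʳ _)

La-factorizations-even : ∀ a {r} → a % 2 ≡ 0 → r ≡ La a →
  IsFact a r (0 , 0 , ⌊ a /2⌋) × IsFact a r (⌊ a /2⌋ + 1 , 0 , 0)
  × len (0 , 0 , ⌊ a /2⌋) ≢ len (⌊ a /2⌋ + 1 , 0 , 0)
La-factorizations-even a a%2≡0 refl =
    sym (La-even a a%2≡0)
  , trans (eval[k,0,0]≡k*a a (h + 1)) (sym (begin
      La a          ≡⟨ La-even a a%2≡0 ⟩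
      h * (a + 2)   ≡⟨ a%2≡0⇒⌊a/2⌋*[a+2]≡[1+⌊a/2⌋]*a a a%2≡0 ⟩
      suc h * a     ≡⟨ cong (_* a) (+-comm 1 h) ⟩
      (h + 1) * a   ∎))
  , λ eq → <⇒≢ (≤-reflexive (+-comm 1 h)) (trans eq (len[k,0,0]≡k (h + 1)))
  where
  h = ⌊ a /2⌋
  open ≡-Reasoning

La-factorizations-odd : ∀ a {r} → a % 2 ≡ 1 → r ≡ La a →
  IsFact a r (0 , 1 , ⌊ a /2⌋) × IsFact a r (⌊ a /2⌋ + 2 , 0 , 0)
  × len (0 , 1 , ⌊ a /2⌋) ≢ len (⌊ a /2⌋ + 2 , 0 , 0)
La-factorizations-odd a a%2≡1 refl =
    trans (subst (λ x → x + 1 + 0 + h * (x + 2) ≡ (h + 2) * x)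
                 (sym (m%2≡1⇒m≡1+[⌊m/2⌋+⌊m/2⌋] a%2≡1)) (identity h))
          (sym (La-odd a a%2≡1))
  , trans (eval[k,0,0]≡k*a a (h + 2)) (sym (La-odd a a%2≡1))
  , λ eq → <⇒≢ (≤-reflexive (+-comm 2 h)) (trans eq (len[k,0,0]≡k (h + 2)))
  where
  h = ⌊ a /2⌋
  identity : ∀ h → suc (h + h) + 1 + 0 + h * (suc (h + h) + 2) ≡ (h + 2) * suc (h + h)
  identity = solve-∀

module _ (a : ℕ) ⦃ _ : NonZero a ⦄ (α : Triple) where

  len≤eval/a : len α ≤ eval a α / a
  len≤eval/a = m*n≤o⇒m≤o/n (len α) (len*a≤eval a α)

  eval/a≤len+sumTerm : 2 ≤ a → eval a α / a ≤ len α + sumTerm a (len α) (len α)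
  eval/a≤len+sumTerm 2≤a = begin
    eval a α / a        ≡⟨ /-congˡ (eval≡len*a+excess a α) ⟩
    (n * a + e) / a     ≡⟨ [m*n+o]/n≡m+o/n n e ⟩
    n + e / a           ≤⟨ +-monoʳ-≤ n e/a≤sumTerm ⟩
    n + sumTerm a n n   ∎
    where
    n = len α
    e = excess α
    open ≤-Reasoning
    e/a≤sumTerm : e / a ≤ sumTerm a n n
    e/a≤sumTerm = +-cancelˡ-≤ n _ _ (subst (n + e / a ≤_) (+-comm _ n)
      (sumTerm-lower 2≤a (≤-trans (m/n*n≤m e a) (excess≤len+len α)) n ≤-refl))

  eval<⌊a/2⌋*a⇒len≡eval/a<⌊a/2⌋ : eval a α < ⌊ a /2⌋ * a →
                                  len α ≡ eval a α / a × eval a α / a < ⌊ a /2⌋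
  eval<⌊a/2⌋*a⇒len≡eval/a<⌊a/2⌋ r<h*a = sym r/a≡n , subst (_< ⌊ a /2⌋) (sym r/a≡n) n<h
    where
    n<h = eval<⌊a/2⌋*a⇒len<⌊a/2⌋ a α r<h*a
    e<a = ≤-trans (n≤1+n _) (len<⌊a/2⌋⇒2+excess≤a a α n<h)
    r/a≡n = trans (/-congˡ (eval≡len*a+excess a α)) ([m*n+o]/n≡m (len α) e<a)

  eval≡⌊a/2⌋*[a+2]⇒len≡eval/a≡⌊a/2⌋ : a % 2 ≡ 1 → eval a α ≡ ⌊ a /2⌋ * (a + 2) →
                                      len α ≡ eval a α / a × eval a α / a ≡ ⌊ a /2⌋
  eval≡⌊a/2⌋*[a+2]⇒len≡eval/a≡⌊a/2⌋ a%2≡1 r≡ =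
    ≤-antisym₃ len≤eval/a (≤-reflexive r/a≡h) (⌊a/2⌋*a≤eval⇒⌊a/2⌋≤len a α h*a≤r)
    where
    r/a≡h = trans (/-congˡ r≡) (a%2≡1⇒⌊a/2⌋*[a+2]/a≡⌊a/2⌋ a a%2≡1)
    h*a≤r = subst (⌊ a /2⌋ * a ≤_) (sym r≡) (*-monoʳ-≤ ⌊ a /2⌋ (m≤m+n a 2))

  ⌊a/2⌋*[a+2]<eval<La⇒len≡eval/a≡⌊a/2⌋+1 : a % 2 ≡ 1 →
                                            ⌊ a /2⌋ * (a + 2) < eval a α → eval a α < La a →
                                            len α ≡ eval a α / a × eval a α / a ≡ ⌊ a /2⌋ + 1
  ⌊a/2⌋*[a+2]<eval<La⇒len≡eval/a≡⌊a/2⌋+1 a%2≡1 lo hi = ≤-antisym₃ len≤eval/a r/a≤h+1 h+1≤n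
    where
    h = ⌊ a /2⌋
    h+1≤n = subst (_≤ len α) (+-comm 1 h) (*[a+2]<eval⇒<len a h α lo)
    r/a≤h+1 = o<[1+m]*n⇒o/n≤m (h + 1) (subst (eval a α <_) (a%2≡1⇒La≡[2+⌊a/2⌋]*a a a%2≡1) hi)

module _ (a : ℕ) ⦃ _ : NonZero a ⦄ {m : ℕ} where

  m<⌊a/2⌋*[a+2]⇒m/a≤⌊a/2⌋ : m < ⌊ a /2⌋ * (a + 2) → m / a ≤ ⌊ a /2⌋
  m<⌊a/2⌋*[a+2]⇒m/a≤⌊a/2⌋ lt = o<[1+m]*n⇒o/n≤m ⌊ a /2⌋ (<-≤-trans lt (⌊a/2⌋*[a+2]≤[1+⌊a/2⌋]*a a))

  La≤m⇒⌊a/2⌋<m/a-even : a % 2 ≡ 0 → La a ≤ m → ⌊ a /2⌋ < m / a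
  La≤m⇒⌊a/2⌋<m/a-even a%2≡0 le = m*n≤o⇒m≤o/n (suc ⌊ a /2⌋)
    (subst (_≤ m) (trans (La-even a a%2≡0) (a%2≡0⇒⌊a/2⌋*[a+2]≡[1+⌊a/2⌋]*a a a%2≡0)) le)

  La≤m⇒⌊a/2⌋+1<m/a-odd : a % 2 ≡ 1 → La a ≤ m → ⌊ a /2⌋ + 1 < m / a
  La≤m⇒⌊a/2⌋+1<m/a-odd a%2≡1 le = m*n≤o⇒m≤o/n (suc (⌊ a /2⌋ + 1))
    (subst (_≤ m) (a%2≡1⇒La≡[2+⌊a/2⌋]*a a a%2≡1) le)

lemma2p3 : (a : ℕ) → 3 ≤ a → (f : ℕ) → IsFrob a f →
  (r : ℕ) → InS a r → r ≢ 0 → (α : Triple) → IsFact a r α →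
  ((len α * a ≤ r × r ≤ len α * (a + 2))
  × (len α ≤ div r a)
  × (div r a ≤ len α + sumTerm a (len α) (len α))
  × (r ≤ f → len α ≡ div r a × div r a < ⌊ a /2⌋)
  × (r > f → ⌊ a /2⌋ ≤ len α)
  × (r < ⌊ a /2⌋ * (a + 2) → div r a ≤ ⌊ a /2⌋)
  × (f < r → r < ⌊ a /2⌋ * (a + 2) → len α ≡ div r a × div r a ≡ ⌊ a /2⌋))
  × (a % 2 ≡ 0 →
      La a ≡ ⌊ a /2⌋ * (a + 2)
      × (r ≥ La a → div r a > ⌊ a /2⌋)
      × (r ≡ La a →
          IsFact a r (0 , 0 , ⌊ a /2⌋)
          × IsFact a r (⌊ a /2⌋ + 1 , 0 , 0)
          × len (0 , 0 , ⌊ a /2⌋) ≢ len (⌊ a /2⌋ + 1 , 0 , 0)))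
  × (a % 2 ≡ 1 →
      La a ≡ (⌊ a /2⌋ + 2) * a
      × (r ≡ ⌊ a /2⌋ * (a + 2) → len α ≡ div r a × div r a ≡ ⌊ a /2⌋)
      × (⌊ a /2⌋ * (a + 2) < r → r < La a →
          len α ≡ div r a × div r a ≡ ⌊ a /2⌋ + 1)
      × (r ≥ La a → div r a > ⌊ a /2⌋ + 1)
      × (r ≡ La a →
          IsFact a r (0 , 1 , ⌊ a /2⌋)
          × IsFact a r (⌊ a /2⌋ + 2 , 0 , 0)
          × len (0 , 1 , ⌊ a /2⌋) ≢ len (⌊ a /2⌋ + 2 , 0 , 0)))
lemma2p3 zero () _ _ _ _ _ _ _
-- Matching a as a successor makes div r a compute to r / a.
lemma2p3 a@(suc _) 3≤a f frob .(eval a α) _ _ α refl =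
    ( (len*a≤eval a α , eval≤len*[a+2] a α)
    , len≤eval/a a α
    , eval/a≤len+sumTerm a α 2≤a
    , eval<⌊a/2⌋*a⇒len≡eval/a<⌊a/2⌋ a α ∘ ≤f⇒<⌊a/2⌋*a
    , ⌊a/2⌋≤len
    , m<⌊a/2⌋*[a+2]⇒m/a≤⌊a/2⌋ a
    , λ f<r r<h[a+2] →
        ≤-antisym₃ (len≤eval/a a α) (m<⌊a/2⌋*[a+2]⇒m/a≤⌊a/2⌋ a r<h[a+2]) (⌊a/2⌋≤len f<r))
  , (λ even → La-even a even , La≤m⇒⌊a/2⌋<m/a-even a even , La-factorizations-even a even)
  , (λ odd → La-odd a odd
           , eval≡⌊a/2⌋*[a+2]⇒len≡eval/a≡⌊a/2⌋ a α odd
           , ⌊a/2⌋*[a+2]<eval<La⇒len≡eval/a≡⌊a/2⌋+1 a α odd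
           , La≤m⇒⌊a/2⌋+1<m/a-odd a odd
           , La-factorizations-odd a odd)
  where
  2≤a : 2 ≤ a
  2≤a = ≤-trans (n≤1+n 2) 3≤a
  1+f≡⌊a/2⌋*a : suc f ≡ ⌊ a /2⌋ * a
  1+f≡⌊a/2⌋*a = IsFrob⇒1+f≡⌊a/2⌋*a a 2≤a frob
  ≤f⇒<⌊a/2⌋*a : ∀ {m} → m ≤ f → m < ⌊ a /2⌋ * a
  ≤f⇒<⌊a/2⌋*a m≤f = ≤-trans (s≤s m≤f) (≤-reflexive 1+f≡⌊a/2⌋*a)
  ⌊a/2⌋≤len : f < eval a α → ⌊ a /2⌋ ≤ len α
  ⌊a/2⌋≤len f<r = ⌊a/2⌋*a≤eval⇒⌊a/2⌋≤len a α (subst (_≤ eval a α) 1+f≡⌊a/2⌋*a f<r)
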